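{- For a positive integer $N$, let $m_N = \min\{ m\ge 1: d(m)=N \}$, where $d(m)$ is the number of positive divisors of $m$, and write $m_N=p_1^{\alpha_1} \cdots p_r^{\alpha_r}$ with $\alpha_r\ge 1$ (so that $\alpha_1,\dots,\alpha_r\ge 0$), where $p_j$ denotes the $j$-th smallest prime. Then: (i) $\alpha_1 \ge \alpha_2\ge \cdots \ge \alpha_r$; (ii) if $N'$ is a positive integer with $N'\mid N$, then $m_{N'}\le m_N$; (iii) for each integer $k\ge 1$ and each $j\le r$, if $p_j>p_{r+1}^{1/2^k}$, then $\Omega(\alpha_j+1)\le k$.
   Context: $\Omega(n)$ denotes the number of prime factors of $n$ counted with multiplicity (the number of prime power divisors of $n$). $p_j$ is the $j$-th smallest prime ($p_1=2$). -}

module Defs where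

open import Data.Nat using (ℕ; zero; suc; _+_; _*_; _^_; _≤_; _<_)
open import Data.Nat.Divisibility using (_∣_; _∣?_)
open import Data.Nat.Primality using (Prime; prime?)
open import Data.List using (List; length; filter; applyUpTo; upTo; cartesianProduct)
open import Data.Product using (_×_; _,_; proj₁; proj₂; ∃)
open import Data.Sum using (_⊎_)
open import Relation.Nullary.Decidable using (_×-dec_)
open import Relation.Binary.PropositionalEquality using (_≡_)

oneTo : ℕ → List ℕ
oneTo n = applyUpTo suc n

numDivisors : ℕ → ℕ
numDivisors m = length (filter (λ k → k ∣? m) (oneTo m))

IsLeastWithDivisorCount : ℕ → ℕ → Set
IsLeastWithDivisorCount N m =
  1 ≤ m × numDivisors m ≡ N × (∀ m' → 1 ≤ m' → numDivisors m' ≡ N → m ≤ m')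

-- π(p): number of primes ≤ p.  A prime p is p_j (the j-th smallest prime) iff π(p) ≡ j.
primeCount : ℕ → ℕ
primeCount p = length (filter prime? (upTo (suc p)))

IsNthPrime : ℕ → ℕ → Set
IsNthPrime j p = Prime p × primeCount p ≡ j

-- exponent of p in m: number of a ∈ [1..m] with p^a ∣ m (correct for p ≥ 2, m ≥ 1)
expo : ℕ → ℕ → ℕ
expo p m = length (filter (λ a → p ^ a ∣? m) (oneTo m))

-- Ω(n): number of prime power divisors q^a (q prime, a ≥ 1) of n, for n ≥ 1
Ω : ℕ → ℕ
Ω n = length (filter (λ qa → prime? (proj₁ qa) ×-dec (proj₁ qa ^ proj₂ qa ∣? n))
                     (cartesianProduct (upTo (suc n)) (oneTo n)))

-- r is the index of the largest prime factor of m (r = 0 iff m has no prime factor),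
-- i.e. m = p_1^α_1 ⋯ p_r^α_r with α_r ≥ 1
IsTopIndex : ℕ → ℕ → Set
IsTopIndex m r =
  (∀ j q → IsNthPrime j q → q ∣ m → j ≤ r) ×
  (r ≡ 0 ⊎ ∃ λ q → IsNthPrime r q × q ∣ m)

module Submission where

-- Everything rests on the multiplicativity of the divisor count d on a prime
-- power: if p is prime, p ∤ y and y ≥ 1, then d(p ^ e * y) = (e + 1) d(y)
-- (numDivisors-^-*).  It is proved by counting: the divisors of p ^ e * y are
-- exactly the p ^ i * v with i ≤ e and v ∣ y, and two duplicate-free lists with
-- the same members have the same length.  The same counting identifies the
-- exponent function expo with the exponent of a p-part m = p ^ e * y, p ∤ y,
-- and gives Ω(q * c) = Ω(c) + 1 for q prime, hence 2 ^ Ω(c) ≤ c.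
--
-- The three claims are then exchange arguments against minimality of m_N:
-- (i)   if a smaller prime had the smaller exponent, swapping the two
--       exponents keeps d = N and decreases m;
-- (ii)  each divisor N′ of d(m) is d(m″) for a divisor m″ of m (induction on m,
--       splitting N′ along d(p ^ e * y) = (e + 1) d(y)), so m_N′ ≤ m″ ≤ m_N;
-- (iii) if α + 1 = a * b with b ≥ 2 and P = p_{r+1} ∤ m_N, trading p ^ (a (b - 1))
--       for P ^ (b - 1) keeps d = N, so p ^ a ≤ P; if Ω(α + 1) > k such a
--       factorisation has a ≥ 2 ^ k, contradicting P < p ^ (2 ^ k).

open import Defs
open import Data.Nat
open import Data.Nat.Properties
open import Data.Nat.Divisibility
open import Data.Nat.Primality
open import Data.Nat.Induction using (<-rec)
open import Data.Nat.Primality.Factorisation using (factorise)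
open import Data.Nat.GCD using (GCD; gcd; gcd[m,n]∣m; gcd[m,n]∣n; gcd-GCD; GCD-*)
open import Data.Nat.Coprimality using (Coprime; coprime-divisor; GCD≡1⇒coprime)
open import Data.Nat.ListAction using (product)
open import Data.List
  using (List; []; _∷_; [_]; length; filter; applyUpTo; upTo; cartesianProduct; map; _++_)
open import Data.List.Properties
  using (length-map; length-++; length-upTo; length-applyUpTo; filter-++; filter-accept; upTo-∷ʳ)
open import Data.List.Membership.Propositional using (_∈_)
open import Data.List.Membership.Propositional.Properties
  using (∈-map⁺; ∈-map⁻; ∈-applyUpTo⁺; ∈-applyUpTo⁻; ∈-filter⁺; ∈-filter⁻; ∈-upTo⁺; ∈-upTo⁻;
         ∈-cartesianProduct⁺; ∈-cartesianProduct⁻)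
open import Data.List.Membership.Propositional.Properties.WithK using (unique∧set⇒bag)
open import Data.List.Relation.Binary.BagAndSetEquality using (∼bag⇒↭)
open import Data.List.Relation.Binary.Permutation.Propositional.Properties using (↭-length)
open import Data.List.Relation.Unary.Any using (here; there)
import Data.List.Relation.Unary.All as All
import Data.List.Relation.Unary.All.Properties as All
open import Data.List.Relation.Unary.AllPairs using ([]; _∷_)
open import Data.List.Relation.Unary.Unique.Propositional using (Unique)
import Data.List.Relation.Unary.Unique.Propositional.Properties as Unique
open import Data.Product using (_×_; _,_; proj₁; proj₂; ∃; ∃₂)
open import Data.Sum using (_⊎_; inj₁; inj₂)
open import Data.Empty using (⊥-elim)
open import Function.Base using (_∘_)
open import Function.Bundles using (_⇔_; mk⇔)
open import Relation.Nullary using (¬_; yes; no)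
open import Relation.Nullary.Decidable using (_×-dec_)
open import Relation.Binary.PropositionalEquality
  using (_≡_; _≢_; refl; sym; trans; cong; cong₂; subst; subst₂; module ≡-Reasoning)
open import Data.Nat.Tactic.RingSolver using (solve-∀)

-- Two duplicate-free lists with the same members are permutations of each
-- other, hence have the same length.  All cardinality computations below
-- (divisor counts, exponents, Ω) reduce to this.
length-unique-⇔ : ∀ {A : Set} {xs ys : List A} → Unique xs → Unique ys →
  (∀ {z} → z ∈ xs ⇔ z ∈ ys) → length xs ≡ length ys
length-unique-⇔ ux uy same = ↭-length (∼bag⇒↭ (unique∧set⇒bag ux uy same))

map-unique-on : ∀ {A B : Set} (f : A → B) {xs : List A} → Unique xs →
  (∀ {a b} → a ∈ xs → b ∈ xs → f a ≡ f b → a ≡ b) → Unique (map f xs)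
map-unique-on f {[]} _ _ = []
map-unique-on f {x ∷ xs} (x∉xs ∷ uxs) inj =
  All.map⁺ (All.tabulate λ z∈ fx≡fz → All.lookup x∉xs z∈ (inj (here refl) (there z∈) fx≡fz))
  ∷ map-unique-on f uxs (λ a∈ b∈ → inj (there a∈) (there b∈))

length-cartesianProduct : ∀ {A B : Set} (xs : List A) (ys : List B) →
  length (cartesianProduct xs ys) ≡ length xs * length ys
length-cartesianProduct [] ys = refl
length-cartesianProduct (x ∷ xs) ys = begin
  length (map (x ,_) ys ++ cartesianProduct xs ys)          ≡⟨ length-++ (map (x ,_) ys) ⟩
  length (map (x ,_) ys) + length (cartesianProduct xs ys)  ≡⟨ cong₂ _+_ (length-map (x ,_) ys)
                                                                        (length-cartesianProduct xs ys) ⟩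
  length ys + length xs * length ys                          ∎
  where open ≡-Reasoning

oneTo-unique : ∀ n → Unique (oneTo n)
oneTo-unique n = Unique.applyUpTo⁺₁ suc n (λ i<j _ → <⇒≢ i<j ∘ suc-injective)

∈-oneTo⁺ : ∀ {a n} → 1 ≤ a → a ≤ n → a ∈ oneTo n
∈-oneTo⁺ {suc a} _ a≤n = ∈-applyUpTo⁺ suc a≤n

∈-oneTo⁻ : ∀ {a n} → a ∈ oneTo n → 1 ≤ a × a ≤ n
∈-oneTo⁻ a∈ with ∈-applyUpTo⁻ suc a∈
... | i , i<n , refl = s≤s z≤n , i<n

prime⇒≥2 : ∀ {p} → Prime p → 2 ≤ p
prime⇒≥2 {p} pp = nonTrivial⇒n>1 p {{prime⇒nonTrivial pp}}

prime⇒≥1 : ∀ {p} → Prime p → 1 ≤ p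
prime⇒≥1 pp = ≤-trans (s≤s z≤n) (prime⇒≥2 pp)

^-≥1 : ∀ {p} → 1 ≤ p → ∀ e → 1 ≤ p ^ e
^-≥1 {p} p≥1 e = m^n>0 p {{>-nonZero p≥1}} e

*-≥1⇒≥1ˡ : ∀ a b → 1 ≤ a * b → 1 ≤ a
*-≥1⇒≥1ˡ (suc a) b _ = s≤s z≤n

∣⇒≥1 : ∀ {a b} → a ∣ b → 1 ≤ b → 1 ≤ a
∣⇒≥1 {zero} a∣b b≥1 = ≤-trans b≥1 (≤-reflexive (0∣⇒≡0 a∣b))
∣⇒≥1 {suc a} _ _ = s≤s z≤n

n<2^n : ∀ n → n < 2 ^ n
n<2^n zero = s≤s z≤n
n<2^n (suc n) = +-mono-≤-< (m^n>0 2 n) (subst (n <_) (sym (+-identityʳ (2 ^ n))) (n<2^n n))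

^-monoʳ-∣ : ∀ p {i j} → i ≤ j → p ^ i ∣ p ^ j
^-monoʳ-∣ p {i} {j} i≤j = divides (p ^ (j ∸ i)) (begin
  p ^ j                ≡⟨ cong (p ^_) (sym (m+[n∸m]≡n i≤j)) ⟩
  p ^ (i + (j ∸ i))    ≡⟨ ^-distribˡ-+-* p i (j ∸ i) ⟩
  p ^ i * p ^ (j ∸ i)  ≡⟨ *-comm (p ^ i) (p ^ (j ∸ i)) ⟩
  p ^ (j ∸ i) * p ^ i  ∎)
  where open ≡-Reasoning

<-^-* : ∀ {p y} e → 2 ≤ p → 1 ≤ y → y < p ^ suc e * y
<-^-* {p} {y} e p≥2 y≥1 = subst (_< p ^ suc e * y) (*-identityˡ y)
  (*-monoˡ-< y {{>-nonZero y≥1}} (<-≤-trans p≥2 (m≤m*n p (p ^ e) {{m^n≢0 p e}})))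
  where instance p≢0 : NonZero p
                 p≢0 = >-nonZero (≤-trans (s≤s z≤n) p≥2)

exponent-≤ : ∀ {p i j w} → .{{NonZero p}} → ¬ p ∣ w → p ^ i ∣ p ^ j * w → i ≤ j
exponent-≤ {p} {i} {j} {w} p∤w pⁱ∣ with i ≤? j
... | yes i≤j = i≤j
... | no i≰j = ⊥-elim (p∤w (*-cancelˡ-∣ (p ^ j) {{m^n≢0 p j}} pʲ⁺¹∣))
  where
  pʲ⁺¹∣ : p ^ j * p ∣ p ^ j * w
  pʲ⁺¹∣ = subst (_∣ p ^ j * w) (*-comm p (p ^ j)) (∣-trans (^-monoʳ-∣ p (≰⇒> i≰j)) pⁱ∣)

exponent-unique : ∀ {p i j v w} → .{{NonZero p}} → ¬ p ∣ v → ¬ p ∣ w →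
  p ^ i * v ≡ p ^ j * w → i ≡ j
exponent-unique {p} {i} {j} {v} {w} p∤v p∤w eq =
  ≤-antisym (exponent-≤ p∤w (subst (p ^ i ∣_) eq (m∣m*n v)))
            (exponent-≤ p∤v (subst (p ^ j ∣_) (sym eq) (m∣m*n w)))

record PowerSplit (p m : ℕ) : Set where
  constructor split
  field
    exponent cofactor : ℕ
    decomposition     : m ≡ p ^ exponent * cofactor
    p∤cofactor        : ¬ p ∣ cofactor
    cofactor≥1        : 1 ≤ cofactor

powerSplit : ∀ {p} → 2 ≤ p → ∀ m → 1 ≤ m → PowerSplit p m
powerSplit {p} p≥2 = <-rec (λ m → 1 ≤ m → PowerSplit p m) divide-out
  where
  divide-out : ∀ m → (∀ {m′} → m′ < m → 1 ≤ m′ → PowerSplit p m′) → 1 ≤ m → PowerSplit p m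
  divide-out m rec m≥1 with p ∣? m
  ... | no p∤m = split 0 m (sym (*-identityˡ m)) p∤m m≥1
  ... | yes (divides q refl) with rec (m<m*n q p {{>-nonZero q≥1}} p≥2) q≥1
    where q≥1 = *-≥1⇒≥1ˡ q p m≥1
  ...   | split e y q≡ p∤y y≥1 = split (suc e) y qp≡ p∤y y≥1
    where
    qp≡ : q * p ≡ p ^ suc e * y
    qp≡ = trans (*-comm q p) (trans (cong (p *_) q≡) (sym (*-assoc p (p ^ e) y)))

prime-∤⇒coprime : ∀ {p v} → Prime p → ¬ p ∣ v → Coprime v p
prime-∤⇒coprime pp p∤v (d∣v , d∣p) with prime⇒irreducible pp d∣p
... | inj₁ d≡1 = d≡1
... | inj₂ refl = ⊥-elim (p∤v d∣v)

prime-∤-^-* : ∀ {q u x} → Prime q → ¬ q ∣ u → ¬ q ∣ x → ∀ a → ¬ q ∣ u ^ a * x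
prime-∤-^-* {q} {u} {x} qq q∤u q∤x zero q∣ = q∤x (subst (q ∣_) (*-identityˡ x) q∣)
prime-∤-^-* {q} {u} {x} qq q∤u q∤x (suc a) q∣
  with euclidsLemma u (u ^ a * x) qq (subst (q ∣_) (*-assoc u (u ^ a) x) q∣)
... | inj₁ q∣u = q∤u q∣u
... | inj₂ q∣rest = prime-∤-^-* qq q∤u q∤x a q∣rest

distinct-primes-∤ : ∀ {p q} → Prime p → Prime q → p ≢ q → ¬ q ∣ p
distinct-primes-∤ pp qq p≢q q∣p with prime⇒irreducible pp q∣p
... | inj₁ refl = <⇒≢ (prime⇒≥2 qq) refl
... | inj₂ q≡p = p≢q (sym q≡p)

coprime-pow-divisor : ∀ {p v y} → Prime p → ¬ p ∣ v → ∀ e → v ∣ p ^ e * y → v ∣ y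
coprime-pow-divisor {p} {v} {y} pp p∤v zero v∣ = subst (v ∣_) (*-identityˡ y) v∣
coprime-pow-divisor {p} {v} {y} pp p∤v (suc e) v∣ =
  coprime-pow-divisor pp p∤v e
    (coprime-divisor (prime-∤⇒coprime pp p∤v) (subst (v ∣_) (*-assoc p (p ^ e) y) v∣))

expo-split : ∀ {p m e y} → 2 ≤ p → m ≡ p ^ e * y → ¬ p ∣ y → 1 ≤ y → expo p m ≡ e
expo-split {p} {m} {e} {y} p≥2 m≡ p∤y y≥1 = begin
  expo p m          ≡⟨ length-unique-⇔ (Unique.filter⁺ (λ a → p ^ a ∣? m) (oneTo-unique m))
                                       (oneTo-unique e) (mk⇔ to from) ⟩
  length (oneTo e)  ≡⟨ length-applyUpTo suc e ⟩
  e                 ∎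
  where
  open ≡-Reasoning
  instance p≢0 : NonZero p
  p≢0 = >-nonZero (≤-trans (s≤s z≤n) p≥2)
  e≤m : e ≤ m
  e≤m = ≤-trans (<⇒≤ (<-≤-trans (n<2^n e) (^-monoˡ-≤ e p≥2)))
                (subst (p ^ e ≤_) (sym m≡) (m≤m*n (p ^ e) y {{>-nonZero y≥1}}))
  to : ∀ {a} → a ∈ filter (λ a → p ^ a ∣? m) (oneTo m) → a ∈ oneTo e
  to a∈ with ∈-filter⁻ (λ a → p ^ a ∣? m) {xs = oneTo m} a∈
  ... | a∈′ , pᵃ∣m = ∈-oneTo⁺ (proj₁ (∈-oneTo⁻ a∈′)) (exponent-≤ p∤y (subst (_ ∣_) m≡ pᵃ∣m))
  from : ∀ {a} → a ∈ oneTo e → a ∈ filter (λ a → p ^ a ∣? m) (oneTo m)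
  from a∈ with ∈-oneTo⁻ a∈
  ... | a≥1 , a≤e = ∈-filter⁺ (λ a → p ^ a ∣? m) (∈-oneTo⁺ a≥1 (≤-trans a≤e e≤m))
                      (∣-trans (^-monoʳ-∣ p a≤e) (subst (p ^ e ∣_) (sym m≡) (m∣m*n y)))

divisors : ℕ → List ℕ
divisors n = filter (_∣? n) (oneTo n)

divisors-unique : ∀ n → Unique (divisors n)
divisors-unique n = Unique.filter⁺ (_∣? n) (oneTo-unique n)

∈-divisors⁺ : ∀ {k n} → 1 ≤ n → k ∣ n → k ∈ divisors n
∈-divisors⁺ {k} {n} n≥1 k∣n =
  ∈-filter⁺ (_∣? n) (∈-oneTo⁺ (∣⇒≥1 k∣n n≥1) (∣⇒≤ {{>-nonZero n≥1}} k∣n)) k∣n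

∈-divisors⁻ : ∀ {k n} → k ∈ divisors n → k ∣ n × 1 ≤ k
∈-divisors⁻ {k} {n} k∈ with ∈-filter⁻ (_∣? n) {xs = oneTo n} k∈
... | k∈′ , k∣n = k∣n , proj₁ (∈-oneTo⁻ k∈′)

-- Multiplicativity of d on a prime power and a coprime cofactor:
-- the divisors of p ^ e * y are exactly the p ^ i * v with i ≤ e and v ∣ y.
numDivisors-^-* : ∀ {p y} → Prime p → ¬ p ∣ y → 1 ≤ y → ∀ e →
  numDivisors (p ^ e * y) ≡ suc e * numDivisors y
numDivisors-^-* {p} {y} pp p∤y y≥1 e = begin
  numDivisors n                        ≡⟨ sym (length-unique-⇔ (map-unique-on f pairs-unique f-inj)
                                                                (divisors-unique n) (mk⇔ to from)) ⟩
  length (map f pairs)                 ≡⟨ length-map f pairs ⟩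
  length pairs                         ≡⟨ length-cartesianProduct (upTo (suc e)) (divisors y) ⟩
  length (upTo (suc e)) * numDivisors y ≡⟨ cong (_* numDivisors y) (length-upTo (suc e)) ⟩
  suc e * numDivisors y                ∎
  where
  open ≡-Reasoning
  instance p≢0 : NonZero p
  p≢0 = prime⇒nonZero pp
  n : ℕ
  n = p ^ e * y
  pairs : List (ℕ × ℕ)
  pairs = cartesianProduct (upTo (suc e)) (divisors y)
  pairs-unique : Unique pairs
  pairs-unique = Unique.cartesianProduct⁺ (Unique.upTo⁺ (suc e)) (divisors-unique y)
  f : ℕ × ℕ → ℕ
  f (i , v) = p ^ i * v
  ∈-pairs⁻ : ∀ {i v} → (i , v) ∈ pairs → i ≤ e × v ∣ y × ¬ p ∣ v × 1 ≤ v
  ∈-pairs⁻ iv∈ with ∈-cartesianProduct⁻ (upTo (suc e)) (divisors y) iv∈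
  ... | i∈ , v∈ with ∈-divisors⁻ v∈
  ...   | v∣y , v≥1 = ≤-pred (∈-upTo⁻ i∈) , v∣y , (λ p∣v → p∤y (∣-trans p∣v v∣y)) , v≥1
  f-inj : ∀ {a b} → a ∈ pairs → b ∈ pairs → f a ≡ f b → a ≡ b
  f-inj {i , v} {j , w} a∈ b∈ eq
    with ∈-pairs⁻ a∈ | ∈-pairs⁻ b∈
  ... | _ , _ , p∤v , _ | _ , _ , p∤w , _ with exponent-unique {p} {i} {j} p∤v p∤w eq
  ...   | refl = cong (i ,_) (*-cancelˡ-≡ v w (p ^ i) {{m^n≢0 p i}} eq)
  to : ∀ {k} → k ∈ map f pairs → k ∈ divisors n
  to k∈ with ∈-map⁻ f k∈
  ... | (i , v) , iv∈ , refl with ∈-pairs⁻ iv∈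
  ...   | i≤e , v∣y , _ , _ =
    ∈-divisors⁺ (*-mono-≤ (^-≥1 (prime⇒≥1 pp) e) y≥1) (*-pres-∣ (^-monoʳ-∣ p i≤e) v∣y)
  from : ∀ {k} → k ∈ divisors n → k ∈ map f pairs
  from k∈ with ∈-divisors⁻ {n = n} k∈
  ... | k∣n , k≥1 with powerSplit (prime⇒≥2 pp) _ k≥1
  ...   | split i v refl p∤v v≥1 =
    ∈-map⁺ f (∈-cartesianProduct⁺ (∈-upTo⁺ (s≤s i≤e)) (∈-divisors⁺ y≥1 v∣y))
    where
    i≤e : i ≤ e
    i≤e = exponent-≤ p∤y (∣-trans (m∣m*n v) k∣n)
    v∣y : v ∣ y
    v∣y = coprime-pow-divisor pp p∤v e (∣-trans (n∣m*n (p ^ i)) k∣n)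

primeCount-suc : ∀ n → primeCount (suc n) ≡ primeCount n + length (filter prime? [ suc n ])
primeCount-suc n = begin
  length (filter prime? (upTo (suc (suc n))))
    ≡⟨ cong (length ∘ filter prime?) (sym (upTo-∷ʳ (suc n))) ⟩
  length (filter prime? (upTo (suc n) ++ [ suc n ]))
    ≡⟨ cong length (filter-++ prime? (upTo (suc n)) [ suc n ]) ⟩
  length (filter prime? (upTo (suc n)) ++ filter prime? [ suc n ])
    ≡⟨ length-++ (filter prime? (upTo (suc n))) ⟩
  primeCount n + length (filter prime? [ suc n ])
    ∎
  where open ≡-Reasoning

primeCount-mono : ∀ {m n} → m ≤ n → primeCount m ≤ primeCount n
primeCount-mono {n = zero} z≤n = ≤-refl
primeCount-mono {m} {suc n} m≤1+n with m≤n⇒m<n∨m≡n m≤1+n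
... | inj₂ refl = ≤-refl
... | inj₁ m<1+n = ≤-trans (primeCount-mono (≤-pred m<1+n))
                           (≤-trans (m≤m+n _ _) (≤-reflexive (sym (primeCount-suc n))))

primeCount-prime : ∀ {n} → Prime (suc n) → primeCount (suc n) ≡ suc (primeCount n)
primeCount-prime {n} pp = begin
  primeCount (suc n)                               ≡⟨ primeCount-suc n ⟩
  primeCount n + length (filter prime? [ suc n ])
    ≡⟨ cong (λ l → primeCount n + length l) (filter-accept prime? pp) ⟩
  primeCount n + 1                                 ≡⟨ +-comm (primeCount n) 1 ⟩
  suc (primeCount n)                               ∎
  where open ≡-Reasoning

nthPrime-mono : ∀ {i j p q} → IsNthPrime i p → IsNthPrime j q → i ≤ j → p ≤ q
nthPrime-mono {p = p} {q} (pp , refl) (qq , refl) i≤j with q <? p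
... | no q≮p = ≮⇒≥ q≮p
nthPrime-mono {p = suc p′} {q} (pp , refl) (qq , refl) i≤j | yes q<p =
  ⊥-elim (<⇒≱ (s≤s (primeCount-mono (≤-pred q<p))) (subst (_≤ primeCount q) (primeCount-prime pp) i≤j))

primePowerDivisors : ℕ → List (ℕ × ℕ)
primePowerDivisors n =
  filter (λ qa → prime? (proj₁ qa) ×-dec (proj₁ qa ^ proj₂ qa ∣? n))
         (cartesianProduct (upTo (suc n)) (oneTo n))

primePowerDivisors-unique : ∀ n → Unique (primePowerDivisors n)
primePowerDivisors-unique n =
  Unique.filter⁺ (λ qa → prime? (proj₁ qa) ×-dec (proj₁ qa ^ proj₂ qa ∣? n))
                 (Unique.cartesianProduct⁺ (Unique.upTo⁺ (suc n)) (oneTo-unique n))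

∈-primePowerDivisors⁺ : ∀ {n q a} → 1 ≤ n → Prime q → 1 ≤ a → q ^ a ∣ n → (q , a) ∈ primePowerDivisors n
∈-primePowerDivisors⁺ {n} {q} {a} n≥1 qq a≥1 qᵃ∣n =
  ∈-filter⁺ (λ qa → prime? (proj₁ qa) ×-dec (proj₁ qa ^ proj₂ qa ∣? n))
    (∈-cartesianProduct⁺ (∈-upTo⁺ (s≤s (≤-trans q≤qᵃ qᵃ≤n)))
                         (∈-oneTo⁺ a≥1 (≤-trans (<⇒≤ a<qᵃ) qᵃ≤n)))
    (qq , qᵃ∣n)
  where
  qᵃ≤n : q ^ a ≤ n
  qᵃ≤n = ∣⇒≤ {{>-nonZero n≥1}} qᵃ∣n
  q≤qᵃ : q ≤ q ^ a
  q≤qᵃ = subst (_≤ q ^ a) (*-identityʳ q) (^-monoʳ-≤ q {{prime⇒nonZero qq}} a≥1)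
  a<qᵃ : a < q ^ a
  a<qᵃ = <-≤-trans (n<2^n a) (^-monoˡ-≤ a (prime⇒≥2 qq))

∈-primePowerDivisors⁻ : ∀ {n q a} → (q , a) ∈ primePowerDivisors n → Prime q × 1 ≤ a × q ^ a ∣ n
∈-primePowerDivisors⁻ {n} qa∈
  with ∈-filter⁻ (λ qa → prime? (proj₁ qa) ×-dec (proj₁ qa ^ proj₂ qa ∣? n))
                 {xs = cartesianProduct (upTo (suc n)) (oneTo n)} qa∈
... | qa∈′ , (qq , qᵃ∣n) =
  qq , proj₁ (∈-oneTo⁻ (proj₂ (∈-cartesianProduct⁻ (upTo (suc n)) (oneTo n) qa∈′))) , qᵃ∣n

prime-∤⇒coprime-^ : ∀ {q u} → Prime q → ¬ q ∣ u → ∀ a → Coprime (u ^ a) q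
prime-∤⇒coprime-^ {q} {u} qq q∤u a = prime-∤⇒coprime qq q∤uᵃ
  where
  q∤1 : ¬ q ∣ 1
  q∤1 q∣1 = <⇒≢ (prime⇒≥2 qq) (sym (∣1⇒≡1 q∣1))
  q∤uᵃ : ¬ q ∣ u ^ a
  q∤uᵃ q∣ = prime-∤-^-* qq q∤u q∤1 a (subst (q ∣_) (sym (*-identityʳ (u ^ a))) q∣)

-- Ω is additive on a prime factor: the prime-power divisors of q * c are
-- those of c together with the one new power q ^ (v + 1), v the exponent of q in c.
Ω-prime-* : ∀ {q c} → Prime q → 1 ≤ c → Ω (q * c) ≡ suc (Ω c)
Ω-prime-* {q} {c} qq c≥1 with powerSplit (prime⇒≥2 qq) c c≥1
... | split v w c≡ q∤w w≥1 =
  length-unique-⇔ (primePowerDivisors-unique (q * c)) new-unique (mk⇔ to from)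
  where
  instance q≢0 : NonZero q
  q≢0 = prime⇒nonZero qq
  qc≡ : q * c ≡ q ^ suc v * w
  qc≡ = trans (cong (q *_) c≡) (sym (*-assoc q (q ^ v) w))
  new-unique : Unique ((q , suc v) ∷ primePowerDivisors c)
  new-unique = All.tabulate (λ z∈ eq → 1+n≰n (exponent-≤ {j = v} q∤w
                  (subst (_ ∣_) c≡ (proj₂ (proj₂ (∈-primePowerDivisors⁻ (subst (_∈ _) (sym eq) z∈)))))))
               ∷ primePowerDivisors-unique c
  to : ∀ {z} → z ∈ primePowerDivisors (q * c) → z ∈ (q , suc v) ∷ primePowerDivisors c
  to {q′ , a} z∈ with ∈-primePowerDivisors⁻ z∈
  ... | q′p , a≥1 , q′ᵃ∣ with q′ ≟ q
  ...   | no q′≢q = there (∈-primePowerDivisors⁺ c≥1 q′p a≥1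
                      (coprime-divisor (prime-∤⇒coprime-^ qq (distinct-primes-∤ q′p qq q′≢q) a) q′ᵃ∣))
  ...   | yes refl with a ≟ suc v
  ...     | yes refl = here refl
  ...     | no a≢1+v = there (∈-primePowerDivisors⁺ c≥1 qq a≥1
                          (subst (q ^ a ∣_) (sym c≡) (∣-trans (^-monoʳ-∣ q a≤v) (m∣m*n w))))
    where
    a≤v : a ≤ v
    a≤v = ≤-pred (≤∧≢⇒< (exponent-≤ q∤w (subst (q ^ a ∣_) qc≡ q′ᵃ∣)) a≢1+v)
  from : ∀ {z} → z ∈ (q , suc v) ∷ primePowerDivisors c → z ∈ primePowerDivisors (q * c)
  from (here refl) = ∈-primePowerDivisors⁺ (*-mono-≤ (prime⇒≥1 qq) c≥1) qq (s≤s z≤n)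
                       (*-monoʳ-∣ q (subst (q ^ v ∣_) (sym c≡) (m∣m*n w)))
  from (there z∈) with ∈-primePowerDivisors⁻ z∈
  ... | q′p , a≥1 , q′ᵃ∣c =
    ∈-primePowerDivisors⁺ (*-mono-≤ (prime⇒≥1 qq) c≥1) q′p a≥1 (∣-trans q′ᵃ∣c (n∣m*n q))

one-or-prime-factor : ∀ n → 1 ≤ n → n ≡ 1 ⊎ ∃ λ q → Prime q × q ∣ n
one-or-prime-factor n n≥1 with factorise n {{>-nonZero n≥1}}
... | record { factors = [] ; isFactorisation = n≡1 } = inj₁ n≡1
... | record { factors = q ∷ qs ; isFactorisation = n≡qqs ; factorsPrime = qq All.∷ _ } =
  inj₂ (q , qq , subst (q ∣_) (sym n≡qqs) (m∣m*n (product qs)))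

-- Each prime factor is at least 2, so 2 ^ Ω c ≤ c.
2^Ω≤ : ∀ c → 1 ≤ c → 2 ^ Ω c ≤ c
2^Ω≤ = <-rec (λ c → 1 ≤ c → 2 ^ Ω c ≤ c) bound-step
  where
  bound-step : ∀ c → (∀ {c′} → c′ < c → 1 ≤ c′ → 2 ^ Ω c′ ≤ c′) → 1 ≤ c → 2 ^ Ω c ≤ c
  bound-step c rec c≥1 with one-or-prime-factor c c≥1
  ... | inj₁ refl = ≤-refl
  ... | inj₂ (q , qq , divides k c≡kq) = subst (λ t → 2 ^ Ω t ≤ t) (sym c≡qk) bound
    where
    c≡qk : c ≡ q * k
    c≡qk = trans c≡kq (*-comm k q)
    k≥1 : 1 ≤ k
    k≥1 = *-≥1⇒≥1ˡ k q (subst (1 ≤_) c≡kq c≥1)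
    k<c : k < c
    k<c = subst (k <_) (sym c≡kq) (m<m*n k q {{>-nonZero k≥1}} (prime⇒≥2 qq))
    bound : 2 ^ Ω (q * k) ≤ q * k
    bound = subst (λ t → 2 ^ t ≤ q * k) (sym (Ω-prime-* qq k≥1)) (*-mono-≤ (prime⇒≥2 qq) (rec k<c k≥1))

-- If Ω n > k then n = a * b with b prime and a ≥ 2 ^ k (as Ω a ≥ k).
Ω-large-cofactor : ∀ {k n} → 1 ≤ n → k < Ω n → ∃₂ λ a b → Prime b × n ≡ a * b × 2 ^ k ≤ a
Ω-large-cofactor {k} {n} n≥1 k<Ωn with one-or-prime-factor n n≥1
... | inj₁ refl = ⊥-elim (≤⇒≯ z≤n k<Ωn)
... | inj₂ (b , bp , divides a n≡ab) = a , b , bp , n≡ab ,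
  ≤-trans (^-monoʳ-≤ 2 k≤Ωa) (2^Ω≤ a a≥1)
  where
  a≥1 : 1 ≤ a
  a≥1 = *-≥1⇒≥1ˡ a b (subst (1 ≤_) n≡ab n≥1)
  k≤Ωa : k ≤ Ω a
  k≤Ωa = ≤-pred (subst (k <_) (trans (cong Ω (trans n≡ab (*-comm a b))) (Ω-prime-* bp a≥1)) k<Ωn)

-- A divisor of a * D is a divisor g of a times a divisor h of D
-- (take g = gcd N′ a; the cofactor N′ / g is prime to a / g).
divisor-of-product : ∀ {N′ a D} → 1 ≤ a → N′ ∣ a * D → ∃₂ λ g h → N′ ≡ h * g × g ∣ a × h ∣ D
divisor-of-product {N′} {a} {D} a≥1 N′∣aD with gcd[m,n]∣m N′ a | gcd[m,n]∣n N′ a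
... | divides h N′≡hg | divides s a≡sg = g , h , N′≡hg , gcd[m,n]∣n N′ a , h∣D
  where
  g : ℕ
  g = gcd N′ a
  instance g≢0 : NonZero g
  g≢0 = >-nonZero (*-≥1⇒≥1ˡ g s (subst (1 ≤_) (trans a≡sg (*-comm s g)) a≥1))
  h⊥s : Coprime h s
  h⊥s = GCD≡1⇒coprime (GCD-* (subst₂ (λ u w → GCD u w (1 * g)) N′≡hg a≡sg
                                       (subst (GCD N′ a) (sym (*-identityˡ g)) (gcd-GCD N′ a))))
  gh∣gsD : g * h ∣ g * (s * D)
  gh∣gsD = subst₂ _∣_ (trans N′≡hg (*-comm h g)) (trans (cong (_* D) a≡sg) (sol s g D)) N′∣aD
    where
    sol : ∀ s g D → s * g * D ≡ g * (s * D)
    sol = solve-∀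
  h∣D : h ∣ D
  h∣D = coprime-divisor h⊥s (*-cancelˡ-∣ g gh∣gsD)

DivisorCountsRealised : ℕ → Set
DivisorCountsRealised m = ∀ {N′} → N′ ∣ numDivisors m → ∃ λ m″ → m″ ∣ m × numDivisors m″ ≡ N′

-- The property passes from y to p ^ e * y (p ∤ y): by d(p ^ e * y) = (e + 1) d(y), a divisor
-- N′ = h * g with g ∣ e + 1 and h ∣ d(y) is realised by p ^ (g - 1) * y″ where d(y″) = h.
realised-^-* : ∀ {p y} → Prime p → ¬ p ∣ y → 1 ≤ y → DivisorCountsRealised y →
  ∀ e → DivisorCountsRealised (p ^ e * y)
realised-^-* {p} {y} pp p∤y y≥1 realised-y e {N′} N′∣d =
  realise (divisor-of-product (s≤s z≤n) (subst (N′ ∣_) (numDivisors-^-* pp p∤y y≥1 e) N′∣d))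
  where
  realise : (∃₂ λ g h → N′ ≡ h * g × g ∣ suc e × h ∣ numDivisors y) →
            ∃ λ m″ → m″ ∣ p ^ e * y × numDivisors m″ ≡ N′
  realise (zero , _ , _ , 0∣1+e , _) with 0∣⇒≡0 0∣1+e
  ... | ()
  realise (suc g , h , N′≡ , 1+g∣ , h∣dy) with realised-y h∣dy
  ... | y″ , y″∣y , dy″ = p ^ g * y″ , *-pres-∣ (^-monoʳ-∣ p (≤-pred (∣⇒≤ 1+g∣))) y″∣y , (begin
    numDivisors (p ^ g * y″)  ≡⟨ numDivisors-^-* pp (λ p∣y″ → p∤y (∣-trans p∣y″ y″∣y)) (∣⇒≥1 y″∣y y≥1) g ⟩
    suc g * numDivisors y″    ≡⟨ cong (suc g *_) dy″ ⟩
    suc g * h                 ≡⟨ *-comm (suc g) h ⟩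
    h * suc g                 ≡⟨ sym N′≡ ⟩
    N′                        ∎)
    where open ≡-Reasoning

-- Every divisor of d(m) is the divisor count of some divisor of m, by induction on m:
-- split off the full power of a prime factor and apply realised-^-*.
numDivisors-divisor : ∀ m → 1 ≤ m → DivisorCountsRealised m
numDivisors-divisor = <-rec (λ m → 1 ≤ m → DivisorCountsRealised m) induction-step
  where
  induction-step : ∀ m → (∀ {m′} → m′ < m → 1 ≤ m′ → DivisorCountsRealised m′) →
                   1 ≤ m → DivisorCountsRealised m
  induction-step m rec m≥1 with one-or-prime-factor m m≥1
  ... | inj₁ refl = λ N′∣1 → 1 , ∣-refl , sym (∣1⇒≡1 N′∣1)
  ... | inj₂ (p , pp , p∣m) with powerSplit (prime⇒≥2 pp) m m≥1
  ...   | split zero y m≡ p∤y y≥1 = ⊥-elim (p∤y (subst (p ∣_) (trans m≡ (*-identityˡ y)) p∣m))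
  ...   | split (suc e) y m≡ p∤y y≥1 =
    subst DivisorCountsRealised (sym m≡)
      (realised-^-* pp p∤y y≥1 (rec (subst (y <_) (sym m≡) (<-^-* e (prime⇒≥2 pp) y≥1)) y≥1) (suc e))

numDivisors-two-primes : ∀ {p q x} → Prime p → Prime q → p ≢ q → ¬ p ∣ x → ¬ q ∣ x → 1 ≤ x →
  ∀ a b → numDivisors (p ^ a * (q ^ b * x)) ≡ suc a * (suc b * numDivisors x)
numDivisors-two-primes {p} {q} {x} pp qq p≢q p∤x q∤x x≥1 a b = begin
  numDivisors (p ^ a * (q ^ b * x))  ≡⟨ numDivisors-^-* pp p∤qᵇx (*-mono-≤ (^-≥1 (prime⇒≥1 qq) b) x≥1) a ⟩
  suc a * numDivisors (q ^ b * x)    ≡⟨ cong (suc a *_) (numDivisors-^-* qq q∤x x≥1 b) ⟩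
  suc a * (suc b * numDivisors x)    ∎
  where
  open ≡-Reasoning
  p∤qᵇx : ¬ p ∣ q ^ b * x
  p∤qᵇx = prime-∤-^-* pp (distinct-primes-∤ qq pp (p≢q ∘ sym)) p∤x b

exchange-< : ∀ {p q x} a t → 1 ≤ p → p < q → 1 ≤ x → 1 ≤ t →
  p ^ (a + t) * (q ^ a * x) < p ^ a * (q ^ (a + t) * x)
exchange-< {p} {q} {x} a t p≥1 p<q x≥1 t≥1 =
  subst₂ _<_ (sym lhs≡) (sym rhs≡) (*-monoʳ-< K {{>-nonZero K≥1}} (^-monoˡ-< t {{>-nonZero t≥1}} p<q))
  where
  K : ℕ
  K = p ^ a * q ^ a * x
  K≥1 : 1 ≤ K
  K≥1 = *-mono-≤ (*-mono-≤ (^-≥1 p≥1 a) (^-≥1 (≤-trans p≥1 (<⇒≤ p<q)) a)) x≥1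
  shuffleˡ : ∀ A T Q X → A * T * (Q * X) ≡ A * Q * X * T
  shuffleˡ = solve-∀
  shuffleʳ : ∀ A Q T X → A * (Q * T * X) ≡ A * Q * X * T
  shuffleʳ = solve-∀
  lhs≡ : p ^ (a + t) * (q ^ a * x) ≡ K * p ^ t
  lhs≡ = trans (cong (_* (q ^ a * x)) (^-distribˡ-+-* p a t)) (shuffleˡ (p ^ a) (p ^ t) (q ^ a) x)
  rhs≡ : p ^ a * (q ^ (a + t) * x) ≡ K * q ^ t
  rhs≡ = trans (cong (λ z → p ^ a * (z * x)) (^-distribˡ-+-* q a t)) (shuffleʳ (p ^ a) (q ^ a) (q ^ t) x)

-- (i) In m_N a smaller prime carries at least the exponent of a larger one:
-- otherwise exchanging the two exponents keeps d(m) = N and decreases m.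
exponents-decreasing : ∀ {N m p q} → IsLeastWithDivisorCount N m → Prime p → Prime q → p < q →
  expo q m ≤ expo p m
exponents-decreasing {N} {m} {p} {q} (m≥1 , dm≡N , least) pp qq p<q
  with powerSplit (prime⇒≥2 pp) m m≥1
... | split a y m≡ p∤y y≥1 with powerSplit (prime⇒≥2 qq) y y≥1
...   | split b x y≡ q∤x x≥1 = subst₂ _≤_ (sym expo-q) (sym expo-p) b≤a
  where
  p≢q : p ≢ q
  p≢q = <⇒≢ p<q
  swap : ∀ A B X → A * (B * X) ≡ B * (A * X)
  swap = solve-∀
  m≡pq : m ≡ p ^ a * (q ^ b * x)
  m≡pq = trans m≡ (cong (p ^ a *_) y≡)
  p∤x : ¬ p ∣ x
  p∤x p∣x = p∤y (subst (p ∣_) (sym y≡) (∣n⇒∣m*n (q ^ b) p∣x))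
  expo-p : expo p m ≡ a
  expo-p = expo-split (prime⇒≥2 pp) m≡ p∤y y≥1
  expo-q : expo q m ≡ b
  expo-q = expo-split (prime⇒≥2 qq) (trans m≡pq (swap (p ^ a) (q ^ b) x))
             (prime-∤-^-* qq (distinct-primes-∤ pp qq p≢q) q∤x a) (*-mono-≤ (^-≥1 (prime⇒≥1 pp) a) x≥1)
  b≤a : b ≤ a
  b≤a with b ≤? a
  ... | yes b≤a = b≤a
  ... | no b≰a = ⊥-elim (<⇒≱ m′<m (least m′ m′≥1 dm′≡N))
    where
    a<b : a < b
    a<b = ≰⇒> b≰a
    t : ℕ
    t = b ∸ a
    b≡a+t : b ≡ a + t
    b≡a+t = sym (m+[n∸m]≡n (<⇒≤ a<b))
    m′ : ℕ
    m′ = p ^ b * (q ^ a * x)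
    m′≥1 : 1 ≤ m′
    m′≥1 = *-mono-≤ (^-≥1 (prime⇒≥1 pp) b) (*-mono-≤ (^-≥1 (prime⇒≥1 qq) a) x≥1)
    dm′≡N : numDivisors m′ ≡ N
    dm′≡N = begin
      numDivisors (p ^ b * (q ^ a * x))  ≡⟨ numDivisors-two-primes pp qq p≢q p∤x q∤x x≥1 b a ⟩
      suc b * (suc a * numDivisors x)    ≡⟨ swap (suc b) (suc a) (numDivisors x) ⟩
      suc a * (suc b * numDivisors x)    ≡⟨ sym (numDivisors-two-primes pp qq p≢q p∤x q∤x x≥1 a b) ⟩
      numDivisors (p ^ a * (q ^ b * x))  ≡⟨ cong numDivisors (sym m≡pq) ⟩
      numDivisors m                      ≡⟨ dm≡N ⟩
      N                                  ∎
      where open ≡-Reasoning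
    m′<m : m′ < m
    m′<m = subst (m′ <_) (sym m≡pq)
             (subst (λ u → p ^ u * (q ^ a * x) < p ^ a * (q ^ u * x)) (sym b≡a+t)
               (exchange-< a t (prime⇒≥1 pp) p<q x≥1 (m<n⇒0<n∸m a<b)))

-- (ii) N′ ∣ N implies m_N′ ≤ m_N: some divisor of m_N has exactly N′ divisors.
least-mono-∣ : ∀ {N m N′ m′} → IsLeastWithDivisorCount N m → N′ ∣ N →
  IsLeastWithDivisorCount N′ m′ → m′ ≤ m
least-mono-∣ (m≥1 , dm≡N , _) N′∣N (_ , _ , least′)
  with numDivisors-divisor _ m≥1 (subst (_ ∣_) (sym dm≡N) N′∣N)
... | m″ , m″∣m , dm″≡N′ = ≤-trans (least′ m″ (∣⇒≥1 m″∣m m≥1) dm″≡N′) (∣⇒≤ {{>-nonZero m≥1}} m″∣m)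

^-regroup : ∀ p c a b x → p ^ (c + a * b) * x ≡ p ^ c * x * (p ^ a) ^ b
^-regroup p c a b x = begin
  p ^ (c + a * b) * x        ≡⟨ cong (_* x) (^-distribˡ-+-* p c (a * b)) ⟩
  p ^ c * p ^ (a * b) * x    ≡⟨ cong (λ z → p ^ c * z * x) (sym (^-*-assoc p a b)) ⟩
  p ^ c * (p ^ a) ^ b * x    ≡⟨ shuffle (p ^ c) ((p ^ a) ^ b) x ⟩
  p ^ c * x * (p ^ a) ^ b    ∎
  where
  open ≡-Reasoning
  shuffle : ∀ C A X → C * A * X ≡ C * X * A
  shuffle = solve-∀

-- If α + 1 = a * b
-- with b ≥ 2, then p ^ a ≤ P: otherwise m′ = P ^ (b - 1) * p ^ (a - 1) * x has the same
-- divisor count b a d(x) but is smaller, as m_N = p ^ (a - 1) * x * (p ^ a) ^ (b - 1).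
exponent-factor-bound : ∀ {N m p P α x} → IsLeastWithDivisorCount N m →
  Prime p → Prime P → ¬ P ∣ m → m ≡ p ^ α * x → ¬ p ∣ x → 1 ≤ x →
  ∀ a b → α + 1 ≡ a * b → 2 ≤ b → p ^ a ≤ P
exponent-factor-bound {α = α} _ _ _ _ _ _ _ zero b α+1≡ _ with trans (+-comm 1 α) α+1≡
... | ()
exponent-factor-bound {N} {m} {p} {P} {α} {x} (m≥1 , dm≡N , least) pp PP P∤m m≡ p∤x x≥1
  a@(suc a′) (suc b′) α+1≡ (s≤s b′≥1)
  with p ^ a ≤? P
... | yes pᵃ≤P = pᵃ≤P
... | no pᵃ≰P = ⊥-elim (<⇒≱ m′<m (least m′ m′≥1 dm′≡N))
  where
  α≡ : α ≡ a′ + a * b′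
  α≡ = suc-injective (trans (+-comm 1 α) (trans α+1≡ (*-suc a b′)))
  K : ℕ
  K = p ^ a′ * x
  K≥1 : 1 ≤ K
  K≥1 = *-mono-≤ (^-≥1 (prime⇒≥1 pp) a′) x≥1
  m≡K* : m ≡ K * (p ^ a) ^ b′
  m≡K* = trans m≡ (trans (cong (λ e → p ^ e * x) α≡) (^-regroup p a′ a b′ x))
  P∤K : ¬ P ∣ K
  P∤K P∣K = P∤m (subst (P ∣_) (sym m≡K*) (∣m⇒∣m*n ((p ^ a) ^ b′) P∣K))
  m′ : ℕ
  m′ = P ^ b′ * K
  m′≥1 : 1 ≤ m′
  m′≥1 = *-mono-≤ (^-≥1 (prime⇒≥1 PP) b′) K≥1
  dm′≡N : numDivisors m′ ≡ N
  dm′≡N = begin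
    numDivisors (P ^ b′ * K)       ≡⟨ numDivisors-^-* PP P∤K K≥1 b′ ⟩
    suc b′ * numDivisors K         ≡⟨ cong (suc b′ *_) (numDivisors-^-* pp p∤x x≥1 a′) ⟩
    suc b′ * (a * numDivisors x)   ≡⟨ sym (*-assoc (suc b′) a (numDivisors x)) ⟩
    suc b′ * a * numDivisors x     ≡⟨ cong (_* numDivisors x) (trans (*-comm (suc b′) a) (sym α+1≡)) ⟩
    (α + 1) * numDivisors x        ≡⟨ cong (_* numDivisors x) (+-comm α 1) ⟩
    suc α * numDivisors x          ≡⟨ sym (numDivisors-^-* pp p∤x x≥1 α) ⟩
    numDivisors (p ^ α * x)        ≡⟨ cong numDivisors (sym m≡) ⟩
    numDivisors m                  ≡⟨ dm≡N ⟩
    N                              ∎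
    where open ≡-Reasoning
  m′<m : m′ < m
  m′<m = subst₂ _<_ (*-comm K (P ^ b′)) (sym m≡K*)
           (*-monoʳ-< K {{>-nonZero K≥1}} (^-monoˡ-< b′ {{>-nonZero b′≥1}} (≰⇒> pᵃ≰P)))

-- (iii) If P is a prime not dividing m_N and P < p ^ (2 ^ k), then Ω(α + 1) ≤ k for the
-- exponent α of p: a larger Ω gives α + 1 = a * b, b prime, a ≥ 2 ^ k, so P ≥ p ^ a ≥ p ^ (2 ^ k).
Ω-exponent-bound : ∀ {N m p P k} → IsLeastWithDivisorCount N m → Prime p → Prime P → ¬ P ∣ m →
  P < p ^ (2 ^ k) → Ω (expo p m + 1) ≤ k
Ω-exponent-bound {N} {m} {p} {P} {k} least@(m≥1 , _) pp PP P∤m P<p^2^k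
  with powerSplit (prime⇒≥2 pp) m m≥1
... | split α x m≡ p∤x x≥1 =
  subst (λ e → Ω (e + 1) ≤ k) (sym (expo-split {e = α} (prime⇒≥2 pp) m≡ p∤x x≥1)) Ω[α+1]≤k
  where
  Ω[α+1]≤k : Ω (α + 1) ≤ k
  Ω[α+1]≤k with k <? Ω (α + 1)
  ... | no k≮Ω = ≮⇒≥ k≮Ω
  ... | yes k<Ω with Ω-large-cofactor {k} {α + 1} (subst (1 ≤_) (+-comm 1 α) (s≤s z≤n)) k<Ω
  ...   | a , b , b-prime , α+1≡ab , 2^k≤a =
    ⊥-elim (<⇒≱ P<p^2^k (≤-trans (^-monoʳ-≤ p {{prime⇒nonZero pp}} 2^k≤a)
      (exponent-factor-bound {α = α} {x} least pp PP P∤m m≡ p∤x x≥1 a b α+1≡ab (prime⇒≥2 b-prime))))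

lemma1 : ∀ (N m r : ℕ) → 1 ≤ N → IsLeastWithDivisorCount N m → IsTopIndex m r →
    (∀ i j p q → 1 ≤ i → i ≤ j → j ≤ r → IsNthPrime i p → IsNthPrime j q →
    expo q m ≤ expo p m)
    ×
    (∀ N' m' → 1 ≤ N' → N' ∣ N → IsLeastWithDivisorCount N' m' → m' ≤ m)
    ×
    (∀ k j p P → 1 ≤ k → 1 ≤ j → j ≤ r → IsNthPrime j p → IsNthPrime (suc r) P →
    P < p ^ (2 ^ k) → Ω (expo p m + 1) ≤ k)
lemma1 N m r _ least (top , _) =
  (λ i j p q _ i≤j _ ip jq → part-i ip jq (nthPrime-mono ip jq i≤j)) ,
  (λ N′ m′ _ N′∣N least′ → least-mono-∣ least N′∣N least′) ,
  (λ k j p P _ _ _ (pp , _) P-next P<p^2^k → Ω-exponent-bound least pp (proj₁ P-next) (P∤m P-next) P<p^2^k)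
  where
  part-i : ∀ {i j p q} → IsNthPrime i p → IsNthPrime j q → p ≤ q → expo q m ≤ expo p m
  part-i {p = p} {q} (pp , _) (qq , _) p≤q with p ≟ q
  ... | yes refl = ≤-refl
  ... | no p≢q = exponents-decreasing least pp qq (≤∧≢⇒< p≤q p≢q)
  P∤m : ∀ {P} → IsNthPrime (suc r) P → ¬ P ∣ m
  P∤m P-next P∣m = 1+n≰n (top (suc r) _ P-next P∣m)
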